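{- Let $\Delta=\Delta(X,Y,T,E)$ be a tableau complex, let $(x,y)\in E$, and let $T_{\mathrm{star}}=\{f\in T: f(x)\ne y\}$. Then the star of $v_{(x,y)}$ in $\Delta$ equals $\Delta(X,Y,T_{\mathrm{star}},E)$.
   Context: Let $X,Y$ be finite sets; a tableau is a function $f:X\to Y$, identified with its graph in $X\times Y$. Let $T$ be a set of tableaux and $E\subseteq X\times Y$ contain every $f\in T$. Put $v_{(x,y)}:=E\setminus\{(x,y)\}$ for $(x,y)\in E$. The tableau complex $\Delta(X,Y,T,E)$ is the simplicial complex on ground set $\{v_{(x,y)}:(x,y)\in E\}$ whose faces are the sets $\{v_{(x,y)}:(x,y)\in E\setminus F\}$ for $F\subseteq E$ containing some $f\in T$. The star of a vertex $v$ is $\mathrm{star}_v\Delta=\{C\in\Delta: C\cup\{v\}\in\Delta\}$. -}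

module Defs where

open import Data.Nat using (ℕ)
open import Data.Fin using (Fin)
open import Data.Bool using (Bool; true; false; _∧_; _∨_; not)
open import Data.Product using (Σ; _×_; ∃)
open import Relation.Binary.PropositionalEquality using (_≡_)
open import Relation.Nullary using (¬_)
open import Data.Fin using (_≟_)
open import Relation.Nullary.Decidable using (⌊_⌋)
open import Level using (Level; suc) renaming (zero to lzero)

-- X = Fin m, Y = Fin n (arbitrary finite sets).
-- A subset of X × Y, represented by its (decidable) characteristic function.
Rel : ℕ → ℕ → Set
Rel m n = Fin m → Fin n → Bool

_⊆_ : ∀ {m n} → Rel m n → Rel m n → Set
A ⊆ B = ∀ x y → A x y ≡ true → B x y ≡ true

Tableau : ℕ → ℕ → Set
Tableau m n = Fin m → Fin n

graph : ∀ {m n} → Tableau m n → Rel m n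
graph f x y = ⌊ f x ≟ y ⌋

TabSet : ℕ → ℕ → Set₁
TabSet m n = Tableau m n → Set

_∖_ : ∀ {m n} → Rel m n → Rel m n → Rel m n
(E ∖ F) x y = E x y ∧ not (F x y)

single : ∀ {m n} → Fin m → Fin n → Rel m n
single x y x' y' = ⌊ x ≟ x' ⌋ ∧ ⌊ y ≟ y' ⌋

_∪_ : ∀ {m n} → Rel m n → Rel m n → Rel m n
(A ∪ B) x y = A x y ∨ B x y

_≐_ : ∀ {m n} → Rel m n → Rel m n → Set
A ≐ B = ∀ x y → A x y ≡ B x y

-- The vertices v_(x,y) = E \ {(x,y)}, (x,y) ∈ E, are pairwise distinct, so
-- a set of vertices {v_(x,y) : (x,y) ∈ C} is identified with its label set
-- C ⊆ E.  A face of Δ(X,Y,T,E) is then a label set C ⊆ E such that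
-- C = E \ F for some F ⊆ E containing some f ∈ T.
IsFace : ∀ {m n} → TabSet m n → Rel m n → Rel m n → Set
IsFace {m} {n} T E C =
  C ⊆ E ×
  Σ (Rel m n) λ F → F ⊆ E × (C ≐ (E ∖ F)) ×
    Σ (Tableau m n) λ f → T f × (graph f ⊆ F)

InStar : ∀ {m n} → TabSet m n → Rel m n → Fin m → Fin n → Rel m n → Set
InStar T E x y C = IsFace T E C × IsFace T E (C ∪ single x y)

Tstar : ∀ {m n} → TabSet m n → Fin m → Fin n → TabSet m n
Tstar T x y f = T f × ¬ (f x ≡ y)

-- A label set C ⊆ E is a face of Δ(X,Y,T,E) exactly when it misses the graph
-- of some f ∈ T (take F = E ∖ C).  Hence C ∪ {(x,y)} is a face exactly when
-- some f ∈ T misses both C and (x,y), i.e. misses C and has f(x) ≠ y, which is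
-- the condition for C to be a face of Δ(X,Y,T_star,E).
module Submission where

open import Defs
open import Data.Nat using (ℕ)
open import Data.Fin using (Fin; _≟_)
open import Data.Bool using (true; false; _∧_; _∨_; not)
open import Data.Bool.Properties using (∧-zeroʳ; ¬-not)
open import Data.Product using (_×_; _,_; proj₁; ∃-syntax)
open import Relation.Nullary using (¬_; Dec; yes)
open import Relation.Nullary.Decidable using (⌊_⌋; isYes≗does; dec-true)
open import Relation.Binary.PropositionalEquality
  using (_≡_; refl; sym; trans; cong; cong₂)

private
  variable
    m n : ℕ

Disjoint : Rel m n → Rel m n → Set
Disjoint A B = ∀ a b → A a b ≡ true → B a b ≡ false

∧-trueˡ : ∀ {p q} → p ∧ q ≡ true → p ≡ true
∧-trueˡ {true} _ = refl

∨-falseˡ : ∀ {p q} → p ∨ q ≡ false → p ≡ false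
∨-falseˡ {false} _ = refl

∨-falseʳ : ∀ {p q} → p ∨ q ≡ false → q ≡ false
∨-falseʳ {false} q≡false = q≡false

isYes-true : ∀ {A : Set} (A? : Dec A) → A → ⌊ A? ⌋ ≡ true
isYes-true A? a = trans (isYes≗does A?) (dec-true A? a)

graph-sound : ∀ (f : Tableau m n) {a b} → graph f a b ≡ true → f a ≡ b
graph-sound f {a} {b} e with f a ≟ b
... | yes fa≡b = fa≡b

graph-complete : ∀ (f : Tableau m n) {a b} → f a ≡ b → graph f a b ≡ true
graph-complete f {a} {b} = isYes-true (f a ≟ b)

single-self : ∀ (x : Fin m) (y : Fin n) → single x y x y ≡ true
single-self x y = cong₂ _∧_ (isYes-true (x ≟ x) refl) (isYes-true (y ≟ y) refl)

single-sound : ∀ {x a : Fin m} {y b : Fin n} → single x y a b ≡ true → x ≡ a × y ≡ b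
single-sound {x = x} {a} {y} {b} e with x ≟ a | y ≟ b
... | yes x≡a | yes y≡b = x≡a , y≡b

∪-single-⊆ : ∀ {C E : Rel m n} {x y} → C ⊆ E → E x y ≡ true → (C ∪ single x y) ⊆ E
∪-single-⊆ {C = C} {x = x} {y} C⊆E Exy a b e with C a b in c
... | true = C⊆E a b c
... | false with refl , refl ← single-sound {x = x} {y = y} e = Exy

∖-involutive : ∀ {C E : Rel m n} → C ⊆ E → C ≐ (E ∖ (E ∖ C))
∖-involutive {C = C} {E} C⊆E a b with C a b in c
... | true rewrite C⊆E a b c = refl
... | false with E a b
...   | true = refl
...   | false = refl

Disjoint-∪⁺ : ∀ {A B C : Rel m n} → Disjoint A B → Disjoint A C → Disjoint A (B ∪ C)
Disjoint-∪⁺ A#B A#C a b e rewrite A#B a b e | A#C a b e = refl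

Disjoint-∪⁻ : ∀ {A B C : Rel m n} → Disjoint A (B ∪ C) → Disjoint A B × Disjoint A C
Disjoint-∪⁻ {B = B} A#B∪C =
  (λ a b e → ∨-falseˡ (A#B∪C a b e)) , (λ a b e → ∨-falseʳ {B a b} (A#B∪C a b e))

graph-Disjoint-single⁺ : ∀ (f : Tableau m n) {x y} → ¬ f x ≡ y → Disjoint (graph f) (single x y)
graph-Disjoint-single⁺ f fx≢y a b e = ¬-not λ xy∈ →
  let x≡a , y≡b = single-sound xy∈
  in fx≢y (trans (cong f x≡a) (trans (graph-sound f e) (sym y≡b)))

graph-Disjoint-single⁻ : ∀ (f : Tableau m n) {x y} → Disjoint (graph f) (single x y) → ¬ f x ≡ y
graph-Disjoint-single⁻ f {x} {y} f#xy fx≡y with () ←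
  trans (sym (single-self x y)) (f#xy x y (graph-complete f fx≡y))

IsFace⇒Disjoint : ∀ {T : TabSet m n} {E C} → IsFace T E C → ∃[ f ] T f × Disjoint (graph f) C
IsFace⇒Disjoint {E = E} {C} (_ , F , _ , C≐E∖F , f , Tf , f⊆F) = f , Tf , f#C
  where
  f#C : Disjoint (graph f) C
  f#C a b e = trans (C≐E∖F a b)
    (trans (cong (λ t → E a b ∧ not t) (f⊆F a b e)) (∧-zeroʳ (E a b)))

Disjoint⇒IsFace : ∀ {T : TabSet m n} {E C} (f : Tableau m n)
  → C ⊆ E → T f → graph f ⊆ E → Disjoint (graph f) C → IsFace T E C
Disjoint⇒IsFace {E = E} {C} f C⊆E Tf f⊆E f#C =
  C⊆E , E ∖ C , (λ a b → ∧-trueˡ) , ∖-involutive C⊆E , f , Tf , f⊆E∖C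
  where
  f⊆E∖C : graph f ⊆ (E ∖ C)
  f⊆E∖C a b e = cong₂ (λ p q → p ∧ not q) (f⊆E a b e) (f#C a b e)

IsFace-mono : ∀ {T T′ : TabSet m n} {E C} → (∀ f → T f → T′ f) → IsFace T E C → IsFace T′ E C
IsFace-mono T⊆T′ (C⊆E , F , F⊆E , C≐E∖F , f , Tf , f⊆F) =
  C⊆E , F , F⊆E , C≐E∖F , f , T⊆T′ f Tf , f⊆F

proposition2p4 : (m n : ℕ) (T : TabSet m n) (E : Rel m n)
    → (∀ f → T f → graph f ⊆ E)
    → (x : Fin m) (y : Fin n) → E x y ≡ true
    → (C : Rel m n)
    → (InStar T E x y C → IsFace (Tstar T x y) E C)
      × (IsFace (Tstar T x y) E C → InStar T E x y C)
proposition2p4 m n T E graph⊆E x y Exy C = star⇒face , face⇒star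
  where
  star⇒face : InStar T E x y C → IsFace (Tstar T x y) E C
  star⇒face ((C⊆E , _) , C∪xy-face)
    with f , Tf , f#C∪xy ← IsFace⇒Disjoint C∪xy-face
    with f#C , f#xy ← Disjoint-∪⁻ f#C∪xy =
    Disjoint⇒IsFace f C⊆E (Tf , graph-Disjoint-single⁻ f f#xy) (graph⊆E f Tf) f#C

  face⇒star : IsFace (Tstar T x y) E C → InStar T E x y C
  face⇒star C-face@(C⊆E , _)
    with f , (Tf , fx≢y) , f#C ← IsFace⇒Disjoint C-face =
    IsFace-mono (λ _ → proj₁) C-face ,
    Disjoint⇒IsFace f (∪-single-⊆ C⊆E Exy) Tf (graph⊆E f Tf)
      (Disjoint-∪⁺ f#C (graph-Disjoint-single⁺ f fx≢y))
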